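{- For $n\ge 0$, $$\left|\mathcal{S}^2_n(132)\right|=\frac{1}{3n+1}\binom{4n}{n}.$$
   Context: $\mathcal{S}^2_n(P)$ denotes the set of permutations $\pi\in\mathcal{S}_{3n}$ that avoid every pattern in $P$ (classical pattern avoidance) and satisfy $\pi_{3i+1}<\pi_{3i+2}$ and $\pi_{3i+1}<\pi_{3i+3}$ for all $0\le i<n$ (permutations of binary shrub forests). -}

module Defs where

open import Data.Bool using (Bool; true; false; _∧_; _∨_; not; if_then_else_)
open import Data.Nat using (ℕ; zero; suc; _<ᵇ_; _≡ᵇ_; _*_)
open import Data.List using (List; []; _∷_; map; concatMap; length; filter; upTo)
open import Data.Bool.ListAction using (any)
open import Data.Bool using (T)
open import Relation.Nullary.Decidable using (Dec)
open import Data.Bool.Properties using (T?)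

-- A permutation of length m is represented in one-line notation as a list
-- [π₁, …, π_m] of natural numbers; we use the value set {0,…,m-1}
-- (only relative order matters for all conditions below).

seqs : ℕ → ℕ → List (List ℕ)
seqs m zero    = [] ∷ []
seqs m (suc k) = concatMap (λ x → map (x ∷_) (seqs m k)) (upTo m)

distinct : List ℕ → Bool
distinct []       = true
distinct (x ∷ xs) = not (any (λ y → x ≡ᵇ y) xs) ∧ distinct xs

perms : ℕ → List (List ℕ)
perms m = filter (λ xs → T? (distinct xs)) (seqs m m)

orderedPairs : List ℕ → List (List ℕ)
orderedPairs []       = []
orderedPairs (y ∷ ys) = map (λ z → y ∷ z ∷ []) ys Data.List.++ orderedPairs ys

-- pattern 132 in one-line: a = π_j, b = π_k with j < k, and π_i < π_k < π_j
is32Above : ℕ → List ℕ → Bool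
is32Above x (b ∷ c ∷ []) = (x <ᵇ c) ∧ (c <ᵇ b)
is32Above x _            = false

contains132 : List ℕ → Bool
contains132 []       = false
contains132 (x ∷ xs) = any (is32Above x) (orderedPairs xs) ∨ contains132 xs

avoids132 : List ℕ → Bool
avoids132 π = not (contains132 π)

-- binary shrub forest condition: π_{3i+1} < π_{3i+2} and π_{3i+1} < π_{3i+3}
-- for every block of three consecutive positions (a list of length 3n)
shrub : List ℕ → Bool
shrub (a ∷ b ∷ c ∷ rest) = (a <ᵇ b) ∧ (a <ᵇ c) ∧ shrub rest
shrub []                 = true
shrub _                  = false

S2-132 : ℕ → List (List ℕ)
S2-132 n = filter (λ π → T? (avoids132 π ∧ shrub π)) (perms (3 * n))

module Submission where

-- We count, for every length m (not only multiples of 3), the 132-avoiding permutations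
-- of {0, …, m - 1} that are shrub-like: each complete block of three starts with its
-- smallest entry, and an incomplete final block [a, b] has a < b.  Let s m be their
-- number; for m = 3n shrub-likeness is the binary shrub condition, so |𝒮²ₙ(132)| = s (3n).
--
-- 1. Decomposition at the maximum.  Writing a good permutation of {0, …, m} as
--    α′ ++ m ∷ β, avoidance of 132 puts every entry of α′ above every entry of β, so α′
--    is a raised good permutation of length p and β a good permutation of length m - p;
--    shrub-likeness forces p = m or p ≡ 2 (mod 3).  Conversely every such gluing is good,
--    whence s (m + 1) = Σ_{p < m, p ≡ 2 (3)} s p · s (m - p) + s m.
-- 2. The Raney numbers raney r n, coefficients of Bʳ for B = 1 + x·B⁴, satisfy
--    Bᵃ·Bᵇ = Bᵃ⁺ᵇ; this solves the recurrence: s (3n + k) = raney (k + 1) n.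
-- 3. Pascal's rule and absorption give C(4n, n) = (3n + 1) · raney 1 n.

open import Data.Nat
open import Data.Nat.Properties
open import Data.Nat.Combinatorics using (_C_; nCk+nC[k+1]≡[n+1]C[k+1]; k>n⇒nCk≡0; nC1≡n)
open import Data.Nat.DivMod using (m*n/n≡m)
open import Data.Nat.Tactic.RingSolver using (solve-∀)
open import Data.Bool using (Bool; true; false; _∧_; _∨_; not; T; if_then_else_)
open import Data.Bool.Properties using (T?; T-∧; T-∨)
open import Data.Bool.ListAction using (any)
open import Data.Unit using (tt)
open import Data.Empty using (⊥-elim)
open import Data.Product using (_×_; _,_; proj₁; proj₂; ∃₂)
open import Data.Sum using (_⊎_; inj₁; inj₂)
open import Data.List using (List; []; _∷_; _++_; map; concatMap; length; filter; upTo; applyUpTo)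
open import Data.List.Properties using (length-++; length-map; length-applyUpTo; map-injective; ∷-injective; ∷-injectiveʳ; ++-cancelˡ)
open import Data.List.Relation.Unary.All as All using (All; []; _∷_)
import Data.List.Relation.Unary.All.Properties as All
open import Data.List.Relation.Unary.Any as Any using (here; there)
open import Data.List.Relation.Unary.Any.Properties using (any⁺; any⁻)
open import Data.List.Relation.Unary.AllPairs using ([]; _∷_)
open import Data.List.Relation.Unary.Unique.Propositional using (Unique)
import Data.List.Relation.Unary.Unique.Propositional.Properties as Unique
open import Data.List.Membership.Propositional using (_∈_; _∉_; find; lose)
open import Data.List.Membership.Propositional.Properties
open import Data.List.Membership.DecPropositional _≟_ using (_∈?_)
open import Function.Base using (_∘_)
open import Function.Bundles using (Equivalence)
open import Relation.Nullary using (¬_; Dec; yes; no)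
open import Relation.Binary.PropositionalEquality
open import Defs

open ≡-Reasoning

Σ : ℕ → (ℕ → ℕ) → ℕ
Σ zero    f = 0
Σ (suc n) f = f 0 + Σ n (λ i → f (suc i))

Σ-cong : ∀ n {f g : ℕ → ℕ} → (∀ i → i < n → f i ≡ g i) → Σ n f ≡ Σ n g
Σ-cong zero    f≗g = refl
Σ-cong (suc n) f≗g = cong₂ _+_ (f≗g 0 z<s) (Σ-cong n (λ i i<n → f≗g (suc i) (s<s i<n)))

Σ-+ : ∀ n (f g : ℕ → ℕ) → Σ n (λ i → f i + g i) ≡ Σ n f + Σ n g
Σ-+ zero    f g = refl
Σ-+ (suc n) f g = begin
  f 0 + g 0 + Σ n (λ i → f (suc i) + g (suc i))
    ≡⟨ cong (f 0 + g 0 +_) (Σ-+ n (λ i → f (suc i)) (λ i → g (suc i))) ⟩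
  f 0 + g 0 + (Σ n (λ i → f (suc i)) + Σ n (λ i → g (suc i)))
    ≡⟨ +-interchange (f 0) (g 0) _ _ ⟩
  f 0 + Σ n (λ i → f (suc i)) + (g 0 + Σ n (λ i → g (suc i))) ∎
  where
  +-interchange : ∀ a b c d → a + b + (c + d) ≡ a + c + (b + d)
  +-interchange = solve-∀

Σ-zero : ∀ n (f : ℕ → ℕ) → (∀ i → f i ≡ 0) → Σ n f ≡ 0
Σ-zero zero    f f≗0 = refl
Σ-zero (suc n) f f≗0 = cong₂ _+_ (f≗0 0) (Σ-zero n _ (λ i → f≗0 (suc i)))

Σ-snoc : ∀ n (f : ℕ → ℕ) → Σ (suc n) f ≡ Σ n f + f n
Σ-snoc zero    f = +-comm (f 0) 0
Σ-snoc (suc n) f = begin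
  f 0 + Σ (suc n) (λ i → f (suc i))         ≡⟨ cong (f 0 +_) (Σ-snoc n (λ i → f (suc i))) ⟩
  f 0 + (Σ n (λ i → f (suc i)) + f (suc n)) ≡⟨ +-assoc (f 0) _ _ ⟨
  f 0 + Σ n (λ i → f (suc i)) + f (suc n)   ∎

-- Raney numbers of order 4: raney r n = r/(4n+r) · C(4n+r, n), the coefficient
-- of xⁿ in B(x)ʳ where B = 1 + x·B⁴.  The defining recursion is the
-- coefficientwise form of Bʳ⁺¹ = Bʳ + x·Bʳ⁺⁴.
raney : ℕ → ℕ → ℕ
raney zero    zero    = 1
raney zero    (suc n) = 0
raney (suc r) zero    = 1
raney (suc r) (suc n) = raney r (suc n) + raney (r + 4) n

raney-at-0 : ∀ r → raney r 0 ≡ 1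
raney-at-0 zero    = refl
raney-at-0 (suc r) = refl

raney-convolution : ∀ n a b → Σ (suc n) (λ i → raney a i * raney b (n ∸ i)) ≡ raney (a + b) n
raney-convolution n zero b = begin
  raney b n + 0 * raney b n + Σ n (λ i → 0 * raney b (n ∸ suc i))
    ≡⟨ cong (raney b n + 0 +_) (Σ-zero n _ (λ i → refl)) ⟩
  raney b n + 0 + 0
    ≡⟨ trans (+-identityʳ _) (+-identityʳ _) ⟩
  raney b n ∎
raney-convolution zero (suc a) b rewrite raney-at-0 b = refl
raney-convolution (suc n) (suc a) b = begin
  raney (suc a) 0 * raney b (suc n) + Σ (suc n) (λ i → raney (suc a) (suc i) * raney b (n ∸ i))
    ≡⟨ cong₂ _+_ (cong (_* raney b (suc n)) (sym (raney-at-0 a))) split-recursion ⟩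
  raney a 0 * raney b (suc n) + (Σ (suc n) left + Σ (suc n) right)
    ≡⟨ +-assoc (raney a 0 * raney b (suc n)) _ _ ⟨
  Σ (suc (suc n)) (λ i → raney a i * raney b (suc n ∸ i)) + Σ (suc n) right
    ≡⟨ cong₂ _+_ (raney-convolution (suc n) a b) (raney-convolution n (a + 4) b) ⟩
  raney (a + b) (suc n) + raney (a + 4 + b) n
    ≡⟨ cong (λ r → raney (a + b) (suc n) + raney r n) (+-shift a b) ⟩
  raney (a + b) (suc n) + raney (a + b + 4) n ∎
  where
  left right : ℕ → ℕ
  left  i = raney a (suc i) * raney b (n ∸ i)
  right i = raney (a + 4) i * raney b (n ∸ i)
  split-recursion : Σ (suc n) (λ i → raney (suc a) (suc i) * raney b (n ∸ i)) ≡ Σ (suc n) left + Σ (suc n) right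
  split-recursion = trans (Σ-cong (suc n) (λ i _ → *-distribʳ-+ (raney b (n ∸ i)) (raney a (suc i)) (raney (a + 4) i)))
                          (Σ-+ (suc n) left right)
  +-shift : ∀ a b → a + 4 + b ≡ a + b + 4
  +-shift = solve-∀

-- M C↓ k is the binomial coefficient C(M, k - 1), taken to be 0 for k = 0.
_C↓_ : ℕ → ℕ → ℕ
M C↓ zero  = 0
M C↓ suc k = M C k

pascal↓ : ∀ M k → suc M C k ≡ M C↓ k + M C k
pascal↓ M zero    = refl
pascal↓ M (suc k) = sym (nCk+nC[k+1]≡[n+1]C[k+1] M k)

absorption : ∀ m k → suc k * (suc m C suc k) ≡ suc m * (m C k)
absorption zero zero = refl
absorption zero (suc k) = begin
  suc (suc k) * (1 C suc (suc k)) ≡⟨ cong (suc (suc k) *_) (k>n⇒nCk≡0 (s<s (z<s {k}))) ⟩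
  suc (suc k) * 0                 ≡⟨ *-zeroʳ (suc (suc k)) ⟩
  0                               ≡⟨ cong (1 *_) (k>n⇒nCk≡0 (z<s {k})) ⟨
  1 * (0 C suc k)                 ∎
absorption (suc m) zero = begin
  1 * (suc (suc m) C 1) ≡⟨ *-identityˡ _ ⟩
  suc (suc m) C 1       ≡⟨ nC1≡n (suc (suc m)) ⟩
  suc (suc m)           ≡⟨ *-identityʳ _ ⟨
  suc (suc m) * 1       ∎
absorption (suc m) (suc k) = begin
  suc (suc k) * (suc (suc m) C suc (suc k))
    ≡⟨ cong (suc (suc k) *_) (nCk+nC[k+1]≡[n+1]C[k+1] (suc m) (suc k)) ⟨
  suc (suc k) * (suc m C suc k + suc m C suc (suc k))
    ≡⟨ expand (suc k) (suc m C suc k) (suc m C suc (suc k)) ⟩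
  suc m C suc k + (suc k * (suc m C suc k) + suc (suc k) * (suc m C suc (suc k)))
    ≡⟨ cong (suc m C suc k +_) (cong₂ _+_ (absorption m k) (absorption m (suc k))) ⟩
  suc m C suc k + (suc m * (m C k) + suc m * (m C suc k))
    ≡⟨ cong (suc m C suc k +_) (*-distribˡ-+ (suc m) (m C k) (m C suc k)) ⟨
  suc m C suc k + suc m * (m C k + m C suc k)
    ≡⟨ cong (λ x → suc m C suc k + suc m * x) (nCk+nC[k+1]≡[n+1]C[k+1] m k) ⟩
  suc m C suc k + suc m * (suc m C suc k) ∎
  where
  expand : ∀ k x y → suc k * (x + y) ≡ x + (k * x + suc k * y)
  expand = solve-∀

-- Consecutive binomials: (k + 1)·C(m, k + 1) + (k + 1)·C(m, k) = (m + 1)·C(m, k),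
-- i.e. (k + 1)·C(m, k + 1) = (m - k)·C(m, k) without subtraction.
binomial-step : ∀ m k → suc k * (m C suc k) + suc k * (m C k) ≡ suc m * (m C k)
binomial-step m k = begin
  suc k * (m C suc k) + suc k * (m C k) ≡⟨ *-distribˡ-+ (suc k) (m C suc k) (m C k) ⟨
  suc k * (m C suc k + m C k)           ≡⟨ cong (suc k *_) (+-comm (m C suc k) (m C k)) ⟩
  suc k * (m C k + m C suc k)           ≡⟨ cong (suc k *_) (nCk+nC[k+1]≡[n+1]C[k+1] m k) ⟩
  suc k * (suc m C suc k)               ≡⟨ absorption m k ⟩
  suc m * (m C k)                       ∎

-- C(4n + 3, n + 1) = 3·C(4n + 3, n), as (n + 1)·C(4n+3, n+1) = (3n + 3)·C(4n+3, n).
binomial-ratio-3 : ∀ n → (4 * n + 3) C suc n ≡ 3 * ((4 * n + 3) C n)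
binomial-ratio-3 n = *-cancelˡ-≡ _ _ (suc n)
  (+-cancelʳ-≡ _ _ _ (trans (binomial-step (4 * n + 3) n) (regroup n ((4 * n + 3) C n))))
  where
  regroup : ∀ n x → suc (4 * n + 3) * x ≡ suc n * (3 * x) + suc n * x
  regroup = solve-∀

binomial-ratio-4n : ∀ n → n * ((4 * n) C n) ≡ suc (3 * n) * ((4 * n) C↓ n)
binomial-ratio-4n zero    = refl
binomial-ratio-4n (suc n) =
  +-cancelʳ-≡ _ _ _ (trans (binomial-step (4 * suc n) n) (regroup n ((4 * suc n) C n)))
  where
  regroup : ∀ n x → suc (4 * suc n) * x ≡ suc (3 * suc n) * x + suc n * x
  regroup = solve-∀

binomial-raney-step : ∀ M n a b → M C n ≡ a + 3 * (M C↓ n) → M C suc n ≡ b + 3 * (M C n) →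
                      suc M C suc n ≡ b + a + 3 * (suc M C n)
binomial-raney-step M n a b split₀ split₁ = begin
  suc M C suc n                             ≡⟨ nCk+nC[k+1]≡[n+1]C[k+1] M n ⟨
  M C n + M C suc n                         ≡⟨ cong₂ _+_ split₀ split₁ ⟩
  a + 3 * (M C↓ n) + (b + 3 * (M C n))      ≡⟨ regroup a (M C↓ n) b (M C n) ⟩
  b + a + 3 * (M C↓ n + M C n)              ≡⟨ cong (λ x → b + a + 3 * x) (pascal↓ M n) ⟨
  b + a + 3 * (suc M C n)                   ∎
  where
  regroup : ∀ a x b y → a + 3 * x + (b + 3 * y) ≡ b + a + 3 * (x + y)
  regroup = solve-∀

binomial-raney-split : ∀ n r → (4 * n + r) C n ≡ raney (suc r) n + 3 * ((4 * n + r) C↓ n)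
binomial-raney-split zero    r       = refl
binomial-raney-split (suc n) zero    =
  subst (λ M → M C suc n ≡ raney 1 (suc n) + 3 * (M C↓ suc n)) (sym (index₀ n))
    (binomial-raney-step (4 * n + 3) n (raney 4 n) 0 (binomial-raney-split n 3) (binomial-ratio-3 n))
  where
  index₀ : ∀ n → 4 * suc n + 0 ≡ suc (4 * n + 3)
  index₀ = solve-∀
binomial-raney-split (suc n) (suc r) =
  subst (λ M → M C suc n ≡ raney (2 + r) (suc n) + 3 * (M C↓ suc n)) (sym (index₁ n r))
    (binomial-raney-step (4 * n + (r + 4)) n (raney (suc r + 4) n) (raney (suc r) (suc n)) (binomial-raney-split n (r + 4))
      (subst (λ M → M C suc n ≡ raney (suc r) (suc n) + 3 * (M C n)) (index₂ n r)
        (binomial-raney-split (suc n) r)))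
  where
  index₁ : ∀ n r → 4 * suc n + suc r ≡ suc (4 * n + (r + 4))
  index₁ = solve-∀
  index₂ : ∀ n r → 4 * suc n + r ≡ 4 * n + (r + 4)
  index₂ = solve-∀

binomial-raney : ∀ n → (4 * n) C n ≡ suc (3 * n) * raney 1 n
binomial-raney n = sym (+-cancelʳ-≡ _ _ _ (begin
  suc (3 * n) * raney 1 n + 3 * (n * X)           ≡⟨ cong (λ x → suc (3 * n) * raney 1 n + 3 * x) (binomial-ratio-4n n) ⟩
  suc (3 * n) * raney 1 n + 3 * (suc (3 * n) * Y) ≡⟨ factor n (raney 1 n) Y ⟩
  suc (3 * n) * (raney 1 n + 3 * Y)               ≡⟨ cong (suc (3 * n) *_) split ⟨
  suc (3 * n) * X                                 ≡⟨ expand n X ⟩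
  X + 3 * (n * X)                                 ∎))
  where
  X Y : ℕ
  X = (4 * n) C n
  Y = (4 * n) C↓ n
  split : X ≡ raney 1 n + 3 * Y
  split = subst (λ M → M C n ≡ raney 1 n + 3 * (M C↓ n)) (+-identityʳ (4 * n)) (binomial-raney-split n 0)
  factor : ∀ n r y → suc (3 * n) * r + 3 * (suc (3 * n) * y) ≡ suc (3 * n) * (r + 3 * y)
  factor = solve-∀
  expand : ∀ n x → suc (3 * n) * x ≡ x + 3 * (n * x)
  expand = solve-∀

raney-closed-form : ∀ n → ((4 * n) C n) / suc (3 * n) ≡ raney 1 n
raney-closed-form n = begin
  ((4 * n) C n) / suc (3 * n)           ≡⟨ cong (_/ suc (3 * n)) (binomial-raney n) ⟩
  suc (3 * n) * raney 1 n / suc (3 * n) ≡⟨ cong (_/ suc (3 * n)) (*-comm (suc (3 * n)) (raney 1 n)) ⟩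
  raney 1 n * suc (3 * n) / suc (3 * n) ≡⟨ m*n/n≡m (raney 1 n) (suc (3 * n)) ⟩
  raney 1 n                             ∎

-- Residue modulo 3, by pattern matching so that mod3 (3 + p) = mod3 p holds definitionally.
mod3 : ℕ → ℕ
mod3 0                   = 0
mod3 1                   = 1
mod3 2                   = 2
mod3 (suc (suc (suc p))) = mod3 p

Σ-mod3 : ∀ n t (g : ℕ → ℕ) → t ≤ 2 →
         Σ (3 * n + t) (λ p → if mod3 p ≡ᵇ 2 then g p else 0) ≡ Σ n (λ i → g (3 * i + 2))
Σ-mod3 zero 0 g _ = refl
Σ-mod3 zero 1 g _ = refl
Σ-mod3 zero 2 g _ = refl
Σ-mod3 zero (suc (suc (suc t))) g (s≤s (s≤s ()))
Σ-mod3 (suc n) t g t≤2 = begin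
  Σ (3 * suc n + t) (λ p → if mod3 p ≡ᵇ 2 then g p else 0)
    ≡⟨ cong (λ l → Σ l (λ p → if mod3 p ≡ᵇ 2 then g p else 0)) (unfold n t) ⟩
  g 2 + Σ (3 * n + t) (λ p → if mod3 p ≡ᵇ 2 then g (3 + p) else 0)
    ≡⟨ cong (g 2 +_) (Σ-mod3 n t (λ p → g (3 + p)) t≤2) ⟩
  g 2 + Σ n (λ i → g (3 + (3 * i + 2)))
    ≡⟨ cong (g 2 +_) (Σ-cong n (λ i _ → cong g (shift i))) ⟩
  g 2 + Σ n (λ i → g (3 * suc i + 2)) ∎
  where
  unfold : ∀ n t → 3 * suc n + t ≡ 3 + (3 * n + t)
  unfold = solve-∀
  shift : ∀ i → 3 + (3 * i + 2) ≡ 3 * suc i + 2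
  shift = solve-∀

decompose : ∀ {i n} k → i ≤ n → 3 * n + 2 + k ≡ 3 * i + 2 + (3 * (n ∸ i) + k)
decompose {i} {n} k i≤n = begin
  3 * n + 2 + k                 ≡⟨ cong (λ x → 3 * x + 2 + k) (m+[n∸m]≡n i≤n) ⟨
  3 * (i + (n ∸ i)) + 2 + k     ≡⟨ regroup i (n ∸ i) k ⟩
  3 * i + 2 + (3 * (n ∸ i) + k) ∎
  where
  regroup : ∀ i d k → 3 * (i + d) + 2 + k ≡ 3 * i + 2 + (3 * d + k)
  regroup = solve-∀

splitTerm : (ℕ → ℕ) → ℕ → ℕ → ℕ
splitTerm s m p = if mod3 p ≡ᵇ 2 then s p * s (m ∸ p) else 0

module SolveRecurrence (s : ℕ → ℕ) (s-zero : s 0 ≡ 1)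
                       (s-suc : ∀ m → s (suc m) ≡ Σ m (splitTerm s m) + s m) where

  Solved : ℕ → Set
  Solved n = (s (3 * n + 0) ≡ raney 1 n) × (s (3 * n + 1) ≡ raney 2 n) × (s (3 * n + 2) ≡ raney 3 n)

  solved-0 : Solved 0
  solved-0 = s-zero , trans (s-suc 0) s-zero , trans (s-suc 1) (trans (s-suc 0) s-zero)

  summand : ∀ {M i n} k → i ≤ n → M ≡ 3 * i + 2 + (3 * (n ∸ i) + k) →
            s (3 * i + 2) ≡ raney 3 i → s (3 * (n ∸ i) + k) ≡ raney (suc k) (n ∸ i) →
            s (3 * i + 2) * s (M ∸ (3 * i + 2)) ≡ raney 3 i * raney (suc k) (n ∸ i)
  summand {M} {i} {n} k i≤n M≡ left right = cong₂ _*_ left (begin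
    s (M ∸ (3 * i + 2))                                   ≡⟨ cong (λ l → s (l ∸ (3 * i + 2))) M≡ ⟩
    s (3 * i + 2 + (3 * (n ∸ i) + k) ∸ (3 * i + 2))       ≡⟨ cong s (m+n∸m≡n (3 * i + 2) (3 * (n ∸ i) + k)) ⟩
    s (3 * (n ∸ i) + k)                                   ≡⟨ right ⟩
    raney (suc k) (n ∸ i)                                 ∎)

  -- Passing from n to n + 1: each length is one step of the recurrence, whose sum is a
  -- convolution of Raney numbers (for 3n + 3 it also absorbs the last summand).
  module _ (n : ℕ) (ih : ∀ i → i ≤ n → Solved i) where

    step₀ : s (3 * suc n + 0) ≡ raney 1 (suc n)
    step₀ = begin
      s (3 * suc n + 0)
        ≡⟨ cong s (index n) ⟩
      s (suc (3 * n + 2))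
        ≡⟨ s-suc (3 * n + 2) ⟩
      Σ (3 * n + 2) (splitTerm s (3 * n + 2)) + s (3 * n + 2)
        ≡⟨ cong₂ _+_ (Σ-mod3 n 2 (λ p → s p * s (3 * n + 2 ∸ p)) (s≤s (s≤s z≤n))) (proj₂ (proj₂ (ih n ≤-refl))) ⟩
      Σ n (λ i → s (3 * i + 2) * s (3 * n + 2 ∸ (3 * i + 2))) + raney 3 n
        ≡⟨ cong₂ _+_ (Σ-cong n term) (sym last) ⟩
      Σ n f + f n
        ≡⟨ Σ-snoc n f ⟨
      Σ (suc n) f
        ≡⟨ raney-convolution n 3 1 ⟩
      raney 1 (suc n) ∎
      where
      index : ∀ n → 3 * suc n + 0 ≡ suc (3 * n + 2)
      index = solve-∀
      f : ℕ → ℕ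
      f i = raney 3 i * raney 1 (n ∸ i)
      term : ∀ i → i < n → s (3 * i + 2) * s (3 * n + 2 ∸ (3 * i + 2)) ≡ f i
      term i i<n = summand 0 (<⇒≤ i<n) (trans (sym (+-identityʳ _)) (decompose 0 (<⇒≤ i<n)))
        (proj₂ (proj₂ (ih i (<⇒≤ i<n)))) (proj₁ (ih (n ∸ i) (m∸n≤m n i)))
      last : f n ≡ raney 3 n
      last = trans (cong (λ d → raney 3 n * raney 1 d) (n∸n≡0 n)) (*-identityʳ (raney 3 n))

    step₁ : s (3 * suc n + 1) ≡ raney 2 (suc n)
    step₁ = begin
      s (3 * suc n + 1)
        ≡⟨ cong s (index₁ n) ⟩
      s (suc (3 * suc n + 0))
        ≡⟨ s-suc (3 * suc n + 0) ⟩
      Σ (3 * suc n + 0) (splitTerm s (3 * suc n + 0)) + s (3 * suc n + 0)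
        ≡⟨ cong₂ _+_ (Σ-mod3 (suc n) 0 (λ p → s p * s (3 * suc n + 0 ∸ p)) z≤n) step₀ ⟩
      Σ (suc n) (λ i → s (3 * i + 2) * s (3 * suc n + 0 ∸ (3 * i + 2))) + raney 1 (suc n)
        ≡⟨ cong (_+ raney 1 (suc n)) (Σ-cong (suc n) term) ⟩
      Σ (suc n) (λ i → raney 3 i * raney 2 (n ∸ i)) + raney 1 (suc n)
        ≡⟨ cong (_+ raney 1 (suc n)) (raney-convolution n 3 2) ⟩
      raney 5 n + raney 1 (suc n)
        ≡⟨ +-comm (raney 5 n) _ ⟩
      raney 2 (suc n) ∎
      where
      index₁ : ∀ n → 3 * suc n + 1 ≡ suc (3 * suc n + 0)
      index₁ = solve-∀
      index₂ : ∀ n → 3 * suc n + 0 ≡ 3 * n + 2 + 1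
      index₂ = solve-∀
      term : ∀ i → i < suc n → s (3 * i + 2) * s (3 * suc n + 0 ∸ (3 * i + 2)) ≡ raney 3 i * raney 2 (n ∸ i)
      term i (s≤s i≤n) = summand 1 i≤n (trans (index₂ n) (decompose 1 i≤n))
        (proj₂ (proj₂ (ih i i≤n))) (proj₁ (proj₂ (ih (n ∸ i) (m∸n≤m n i))))

    step₂ : s (3 * suc n + 2) ≡ raney 3 (suc n)
    step₂ = begin
      s (3 * suc n + 2)
        ≡⟨ cong s (index₁ n) ⟩
      s (suc (3 * suc n + 1))
        ≡⟨ s-suc (3 * suc n + 1) ⟩
      Σ (3 * suc n + 1) (splitTerm s (3 * suc n + 1)) + s (3 * suc n + 1)
        ≡⟨ cong₂ _+_ (Σ-mod3 (suc n) 1 (λ p → s p * s (3 * suc n + 1 ∸ p)) (s≤s z≤n)) step₁ ⟩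
      Σ (suc n) (λ i → s (3 * i + 2) * s (3 * suc n + 1 ∸ (3 * i + 2))) + raney 2 (suc n)
        ≡⟨ cong (_+ raney 2 (suc n)) (Σ-cong (suc n) term) ⟩
      Σ (suc n) (λ i → raney 3 i * raney 3 (n ∸ i)) + raney 2 (suc n)
        ≡⟨ cong (_+ raney 2 (suc n)) (raney-convolution n 3 3) ⟩
      raney 6 n + raney 2 (suc n)
        ≡⟨ +-comm (raney 6 n) _ ⟩
      raney 3 (suc n) ∎
      where
      index₁ : ∀ n → 3 * suc n + 2 ≡ suc (3 * suc n + 1)
      index₁ = solve-∀
      index₂ : ∀ n → 3 * suc n + 1 ≡ 3 * n + 2 + 2
      index₂ = solve-∀
      term : ∀ i → i < suc n → s (3 * i + 2) * s (3 * suc n + 1 ∸ (3 * i + 2)) ≡ raney 3 i * raney 3 (n ∸ i)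
      term i (s≤s i≤n) = summand 2 i≤n (trans (index₂ n) (decompose 2 i≤n))
        (proj₂ (proj₂ (ih i i≤n))) (proj₂ (proj₂ (ih (n ∸ i) (m∸n≤m n i))))

  solved : ∀ N n → n ≤ N → Solved n
  solved N       zero    _         = solved-0
  solved (suc N) (suc n) (s≤s n≤N) = step₀ n ih , step₁ n ih , step₂ n ih
    where
    ih : ∀ i → i ≤ n → Solved i
    ih i i≤n = solved N i (≤-trans i≤n n≤N)

  s-closed-form : ∀ n → s (3 * n) ≡ raney 1 n
  s-closed-form n = trans (cong s (sym (+-identityʳ (3 * n)))) (proj₁ (solved n n ≤-refl))

∧-elim : ∀ {x y} → T (x ∧ y) → T x × T y
∧-elim {x} = Equivalence.to (T-∧ {x})

∧-intro : ∀ {x y} → T x → T y → T (x ∧ y)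
∧-intro {x} tx ty = Equivalence.from (T-∧ {x}) (tx , ty)

not-elim : ∀ {x} → T (not x) → ¬ T x
not-elim {false} _ ()

not-intro : ∀ {x} → ¬ T x → T (not x)
not-intro {false} _   = tt
not-intro {true}  ¬tt = ¬tt tt

concatMap-unique : ∀ {A B : Set} (f : A → List B) (xs : List A) → Unique xs →
  (∀ {x} → x ∈ xs → Unique (f x)) →
  (∀ {x y z} → x ∈ xs → y ∈ xs → z ∈ f x → z ∈ f y → x ≡ y) →
  Unique (concatMap f xs)
concatMap-unique f []       _          _       _        = []
concatMap-unique f (x ∷ xs) (x∉ ∷ xs!) f-unique disjoint =
  Unique.++⁺ (f-unique (here refl))
    (concatMap-unique f xs xs! (λ p → f-unique (there p)) (λ p q → disjoint (there p) (there q)))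
    λ { (z∈fx , z∈rest) → let (y , y∈xs , z∈fy) = find (∈-concatMap⁻ f {xs = xs} z∈rest) in
        All.lookup x∉ y∈xs (disjoint (here refl) (there y∈xs) z∈fx z∈fy) }

∈-delete : ∀ {A : Set} {x z : A} ys₁ ys₂ → z ∈ ys₁ ++ x ∷ ys₂ → z ≢ x → z ∈ ys₁ ++ ys₂
∈-delete []        ys₂ (here refl) z≢x = ⊥-elim (z≢x refl)
∈-delete []        ys₂ (there z∈)  z≢x = z∈
∈-delete (y ∷ ys₁) ys₂ (here refl) z≢x = here refl
∈-delete (y ∷ ys₁) ys₂ (there z∈)  z≢x = there (∈-delete ys₁ ys₂ z∈ z≢x)

unique-length-≤ : ∀ {A : Set} (xs ys : List A) → Unique xs → (∀ {z} → z ∈ xs → z ∈ ys) → length xs ≤ length ys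
unique-length-≤ []       ys _          _   = z≤n
unique-length-≤ (x ∷ xs) ys (x∉ ∷ xs!) sub with ∈-∃++ (sub (here refl))
... | ys₁ , ys₂ , refl =
  ≤-trans (s≤s (unique-length-≤ xs (ys₁ ++ ys₂) xs! sub′)) (≤-reflexive (length-delete ys₁ ys₂))
  where
  length-delete : ∀ ys₁ ys₂ → suc (length (ys₁ ++ ys₂)) ≡ length (ys₁ ++ x ∷ ys₂)
  length-delete []        ys₂ = refl
  length-delete (y ∷ ys₁) ys₂ = cong suc (length-delete ys₁ ys₂)
  sub′ : ∀ {z} → z ∈ xs → z ∈ ys₁ ++ ys₂
  sub′ z∈ = ∈-delete ys₁ ys₂ (sub (there z∈)) (λ z≡x → All.lookup x∉ z∈ (sym z≡x))

unique-length-≡ : ∀ {A : Set} (xs ys : List A) → Unique xs → Unique ys →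
  (∀ {z} → z ∈ xs → z ∈ ys) → (∀ {z} → z ∈ ys → z ∈ xs) → length xs ≡ length ys
unique-length-≡ xs ys xs! ys! xs⊆ys ys⊆xs =
  ≤-antisym (unique-length-≤ xs ys xs! xs⊆ys) (unique-length-≤ ys xs ys! ys⊆xs)

pigeonhole : ∀ (xs : List ℕ) lo hi → Unique xs → All (λ x → lo ≤ x × x < hi) xs → length xs ≤ hi ∸ lo
pigeonhole xs lo hi xs! bounded =
  ≤-trans (unique-length-≤ xs interval xs! sub) (≤-reflexive (length-applyUpTo (lo +_) (hi ∸ lo)))
  where
  interval : List ℕ
  interval = applyUpTo (lo +_) (hi ∸ lo)
  sub : ∀ {z} → z ∈ xs → z ∈ interval
  sub z∈ with All.lookup bounded z∈
  ... | lo≤z , z<hi = subst (_∈ interval) (m+[n∸m]≡n lo≤z) (∈-applyUpTo⁺ (lo +_) (∸-monoˡ-< z<hi lo≤z))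

∈-seqs⁻ : ∀ m k {xs} → xs ∈ seqs m k → length xs ≡ k × All (_< m) xs
∈-seqs⁻ m zero    (here refl) = refl , []
∈-seqs⁻ m (suc k) xs∈ with find (∈-concatMap⁻ (λ x → map (x ∷_) (seqs m k)) {xs = upTo m} xs∈)
... | x , x∈ , ∈map with ∈-map⁻ (x ∷_) ∈map
... | ys , ys∈ , refl with ∈-seqs⁻ m k ys∈
... | length≡ , bounded = cong suc length≡ , ∈-upTo⁻ x∈ ∷ bounded

∈-seqs⁺ : ∀ m k {xs} → length xs ≡ k → All (_< m) xs → xs ∈ seqs m k
∈-seqs⁺ m zero    {[]}     _       _              = here refl
∈-seqs⁺ m (suc k) {x ∷ xs} length≡ (x<m ∷ bounded) =
  ∈-concatMap⁺ (λ x → map (x ∷_) (seqs m k)) {xs = upTo m}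
    (Any.map (λ { refl → ∈-map⁺ (x ∷_) (∈-seqs⁺ m k (suc-injective length≡) bounded) }) (∈-upTo⁺ x<m))

seqs-unique : ∀ m k → Unique (seqs m k)
seqs-unique m zero    = [] ∷ []
seqs-unique m (suc k) = concatMap-unique (λ x → map (x ∷_) (seqs m k)) (upTo m) (Unique.upTo⁺ m)
  (λ _ → Unique.map⁺ (λ { refl → refl }) (seqs-unique m k))
  (λ _ _ p q → let (_ , _ , e₁) = ∈-map⁻ _ p ; (_ , _ , e₂) = ∈-map⁻ _ q in
     cong (λ { [] → 0 ; (h ∷ _) → h }) (trans (sym e₁) e₂))

fresh⁻ : ∀ x xs → T (not (any (λ y → x ≡ᵇ y) xs)) → All (x ≢_) xs
fresh⁻ x xs fresh = All.¬Any⇒All¬ xs (λ x∈ → not-elim fresh (any⁺ _ (Any.map (≡⇒≡ᵇ x _) x∈)))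

fresh⁺ : ∀ x xs → All (x ≢_) xs → T (not (any (λ y → x ≡ᵇ y) xs))
fresh⁺ x xs x∉ = not-intro (λ t → All.All¬⇒¬Any x∉ (Any.map (≡ᵇ⇒≡ x _) (any⁻ _ xs t)))

distinct⇒unique : ∀ xs → T (distinct xs) → Unique xs
distinct⇒unique []       _ = []
distinct⇒unique (x ∷ xs) t = let (x∉ , xs!) = ∧-elim {not (any (λ y → x ≡ᵇ y) xs)} t in
  fresh⁻ x xs x∉ ∷ distinct⇒unique xs xs!

unique⇒distinct : ∀ xs → Unique xs → T (distinct xs)
unique⇒distinct []       _          = tt
unique⇒distinct (x ∷ xs) (x∉ ∷ xs!) = ∧-intro (fresh⁺ x xs x∉) (unique⇒distinct xs xs!)

record IsPerm (m : ℕ) (π : List ℕ) : Set where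
  constructor isPerm
  field
    length≡ : length π ≡ m
    bounded : All (_< m) π
    unique  : Unique π

∈-perms⁻ : ∀ m {π} → π ∈ perms m → IsPerm m π
∈-perms⁻ m {π} π∈ with ∈-filter⁻ (λ xs → T? (distinct xs)) {xs = seqs m m} π∈
... | π∈seqs , π-distinct = let (length≡ , bounded) = ∈-seqs⁻ m m π∈seqs in
  isPerm length≡ bounded (distinct⇒unique π π-distinct)

∈-perms⁺ : ∀ m {π} → IsPerm m π → π ∈ perms m
∈-perms⁺ m {π} (isPerm length≡ bounded π!) =
  ∈-filter⁺ (λ xs → T? (distinct xs)) (∈-seqs⁺ m m length≡ bounded) (unique⇒distinct π π!)

perms-unique : ∀ m → Unique (perms m)
perms-unique m = Unique.filter⁺ (λ xs → T? (distinct xs)) (seqs-unique m m)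

data Before (b c : ℕ) : List ℕ → Set where
  first : ∀ {xs}   → c ∈ xs → Before b c (b ∷ xs)
  next  : ∀ {x xs} → Before b c xs → Before b c (x ∷ xs)

data Has132 : List ℕ → Set where
  startsHere  : ∀ {a b c xs} → a < c → c < b → Before b c xs → Has132 (a ∷ xs)
  startsLater : ∀ {x xs} → Has132 xs → Has132 (x ∷ xs)

∈-orderedPairs⁻ : ∀ xs {ps} → ps ∈ orderedPairs xs → ∃₂ λ b c → ps ≡ b ∷ c ∷ [] × Before b c xs
∈-orderedPairs⁻ (y ∷ ys) ps∈ with ∈-++⁻ (map (λ z → y ∷ z ∷ []) ys) ps∈
... | inj₁ ps∈now  = let (z , z∈ , ps≡) = ∈-map⁻ (λ z → y ∷ z ∷ []) ps∈now in y , z , ps≡ , first z∈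
... | inj₂ ps∈rest = let (b , c , ps≡ , b⇢c) = ∈-orderedPairs⁻ ys ps∈rest in b , c , ps≡ , next b⇢c

∈-orderedPairs⁺ : ∀ {b c} xs → Before b c xs → (b ∷ c ∷ []) ∈ orderedPairs xs
∈-orderedPairs⁺ (y ∷ ys) (first c∈) = ∈-++⁺ˡ (∈-map⁺ (λ z → y ∷ z ∷ []) c∈)
∈-orderedPairs⁺ (y ∷ ys) (next b⇢c) = ∈-++⁺ʳ (map (λ z → y ∷ z ∷ []) ys) (∈-orderedPairs⁺ ys b⇢c)

contains132⇒Has132 : ∀ xs → T (contains132 xs) → Has132 xs
contains132⇒Has132 (x ∷ xs) t with Equivalence.to (T-∨ {any (is32Above x) (orderedPairs xs)}) t
... | inj₂ later = startsLater (contains132⇒Has132 xs later)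
... | inj₁ now with find (any⁻ (is32Above x) (orderedPairs xs) now)
... | ps , ps∈ , is32 with ∈-orderedPairs⁻ xs ps∈
... | b , c , refl , b⇢c = let (x<c , c<b) = ∧-elim {x <ᵇ c} is32 in
  startsHere (<ᵇ⇒< x c x<c) (<ᵇ⇒< c b c<b) b⇢c

Has132⇒contains132 : ∀ xs → Has132 xs → T (contains132 xs)
Has132⇒contains132 (a ∷ xs) (startsHere a<c c<b b⇢c) =
  Equivalence.from (T-∨ {any (is32Above a) (orderedPairs xs)})
    (inj₁ (any⁺ (is32Above a) (lose (∈-orderedPairs⁺ xs b⇢c) (∧-intro (<⇒<ᵇ a<c) (<⇒<ᵇ c<b)))))
Has132⇒contains132 (x ∷ xs) (startsLater h) =
  Equivalence.from (T-∨ {any (is32Above x) (orderedPairs xs)}) (inj₂ (Has132⇒contains132 xs h))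

avoids132⇒¬Has132 : ∀ xs → T (avoids132 xs) → ¬ Has132 xs
avoids132⇒¬Has132 xs avoids h = not-elim avoids (Has132⇒contains132 xs h)

¬Has132⇒avoids132 : ∀ xs → ¬ Has132 xs → T (avoids132 xs)
¬Has132⇒avoids132 xs ¬h = not-intro (λ t → ¬h (contains132⇒Has132 xs t))

-- The pattern 132 only depends on relative order, so it survives shifting all values by k.
Before-map⁺ : ∀ (f : ℕ → ℕ) {b c xs} → Before b c xs → Before (f b) (f c) (map f xs)
Before-map⁺ f (first c∈) = first (∈-map⁺ f c∈)
Before-map⁺ f (next b⇢c) = next (Before-map⁺ f b⇢c)

Before-map⁻ : ∀ (f : ℕ → ℕ) {b′ c′} xs → Before b′ c′ (map f xs) →
              ∃₂ λ b c → b′ ≡ f b × c′ ≡ f c × Before b c xs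
Before-map⁻ f (x ∷ xs) (first c′∈) = let (c , c∈ , c′≡) = ∈-map⁻ f c′∈ in x , c , refl , c′≡ , first c∈
Before-map⁻ f (x ∷ xs) (next b⇢c) =
  let (b , c , b′≡ , c′≡ , b⇢c′) = Before-map⁻ f xs b⇢c in b , c , b′≡ , c′≡ , next b⇢c′

Has132-shift⁺ : ∀ k xs → Has132 xs → Has132 (map (k +_) xs)
Has132-shift⁺ k (a ∷ xs) (startsHere a<c c<b b⇢c) =
  startsHere (+-monoʳ-< k a<c) (+-monoʳ-< k c<b) (Before-map⁺ (k +_) b⇢c)
Has132-shift⁺ k (x ∷ xs) (startsLater h) = startsLater (Has132-shift⁺ k xs h)

Has132-shift⁻ : ∀ k xs → Has132 (map (k +_) xs) → Has132 xs
Has132-shift⁻ k (a ∷ xs) (startsHere a<c c<b b⇢c) with Before-map⁻ (k +_) xs b⇢c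
... | b , c , refl , refl , b⇢c′ = startsHere (+-cancelˡ-< k _ _ a<c) (+-cancelˡ-< k _ _ c<b) b⇢c′
Has132-shift⁻ k (x ∷ xs) (startsLater h) = startsLater (Has132-shift⁻ k xs h)

Before⇒∈₁ : ∀ {b c xs} → Before b c xs → b ∈ xs
Before⇒∈₁ (first c∈) = here refl
Before⇒∈₁ (next b⇢c) = there (Before⇒∈₁ b⇢c)

Before⇒∈₂ : ∀ {b c xs} → Before b c xs → c ∈ xs
Before⇒∈₂ (first c∈) = there c∈
Before⇒∈₂ (next b⇢c) = there (Before⇒∈₂ b⇢c)

Before-++ˡ : ∀ {b c xs} ys → Before b c xs → Before b c (xs ++ ys)
Before-++ˡ ys (first c∈) = first (∈-++⁺ˡ c∈)
Before-++ˡ ys (next b⇢c) = next (Before-++ˡ ys b⇢c)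

Before-++ʳ : ∀ {b c ys} xs → Before b c ys → Before b c (xs ++ ys)
Before-++ʳ []       b⇢c = b⇢c
Before-++ʳ (x ∷ xs) b⇢c = next (Before-++ʳ xs b⇢c)

Before-split : ∀ {b c} xs ys → Before b c (xs ++ ys) → Before b c xs ⊎ c ∈ ys
Before-split []       ys b⇢c = inj₂ (Before⇒∈₂ b⇢c)
Before-split (x ∷ xs) ys (first c∈) with ∈-++⁻ xs c∈
... | inj₁ c∈xs = inj₁ (first c∈xs)
... | inj₂ c∈ys = inj₂ c∈ys
Before-split (x ∷ xs) ys (next b⇢c) with Before-split xs ys b⇢c
... | inj₁ b⇢c′ = inj₁ (next b⇢c′)
... | inj₂ c∈ys = inj₂ c∈ys

Has132-++ˡ : ∀ {xs} ys → Has132 xs → Has132 (xs ++ ys)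
Has132-++ˡ ys (startsHere a<c c<b b⇢c) = startsHere a<c c<b (Before-++ˡ ys b⇢c)
Has132-++ˡ ys (startsLater h)          = startsLater (Has132-++ˡ ys h)

Has132-++ʳ : ∀ {ys} xs → Has132 ys → Has132 (xs ++ ys)
Has132-++ʳ []       h = h
Has132-++ʳ (x ∷ xs) h = startsLater (Has132-++ʳ xs h)

Has132-around : ∀ α {m β a b} → a ∈ α → b ∈ β → a < b → b < m → Has132 (α ++ m ∷ β)
Has132-around (x ∷ α) (here refl) b∈ a<b b<m = startsHere a<b b<m (Before-++ʳ α (first b∈))
Has132-around (x ∷ α) (there a∈) b∈ a<b b<m = startsLater (Has132-around α a∈ b∈ a<b b<m)

Has132-split : ∀ α m β → All (_< m) α → All (_< m) β → (∀ {a b} → a ∈ α → b ∈ β → b < a) →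
               Has132 (α ++ m ∷ β) → Has132 α ⊎ Has132 β
Has132-split [] m β _ β<m _ (startsHere m<c c<b b⇢c) =
  ⊥-elim (<-asym (<-trans m<c c<b) (All.lookup β<m (Before⇒∈₁ b⇢c)))
Has132-split [] m β _ _ _ (startsLater h) = inj₂ h
Has132-split (a ∷ α) m β (_ ∷ α<m) β<m β<α (startsHere a<c c<b b⇢c) with Before-split α (m ∷ β) b⇢c
... | inj₁ b⇢c′            = inj₁ (startsHere a<c c<b b⇢c′)
... | inj₂ (here refl)     = ⊥-elim (<-irrefl refl (<-≤-trans c<b (at-most-m (Before⇒∈₁ b⇢c))))
  where
  at-most-m : ∀ {y} → y ∈ α ++ m ∷ β → y ≤ m
  at-most-m y∈ with ∈-++⁻ α y∈
  ... | inj₁ y∈α         = <⇒≤ (All.lookup α<m y∈α)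
  ... | inj₂ (here refl) = ≤-refl
  ... | inj₂ (there y∈β) = <⇒≤ (All.lookup β<m y∈β)
... | inj₂ (there c∈β) = ⊥-elim (<-asym a<c (β<α (here refl) c∈β))
Has132-split (a ∷ α) m β (_ ∷ α<m) β<m β<α (startsLater h)
  with Has132-split α m β α<m β<m (λ p q → β<α (there p) q) h
... | inj₁ hα = inj₁ (startsLater hα)
... | inj₂ hβ = inj₂ hβ

partialShrub : List ℕ → Bool
partialShrub (a ∷ b ∷ c ∷ rest) = (a <ᵇ b) ∧ (a <ᵇ c) ∧ partialShrub rest
partialShrub (a ∷ b ∷ [])       = a <ᵇ b
partialShrub (a ∷ [])           = true
partialShrub []                 = true

shrub≡partialShrub : ∀ n π → length π ≡ 3 * n → shrub π ≡ partialShrub π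
shrub≡partialShrub zero    []        _   = refl
shrub≡partialShrub (suc n) π         len = blocks π (trans len (three-more n))
  where
  three-more : ∀ n → 3 * suc n ≡ 3 + 3 * n
  three-more = solve-∀
  blocks : ∀ π → length π ≡ 3 + 3 * n → shrub π ≡ partialShrub π
  blocks (a ∷ b ∷ c ∷ rest) len = cong (λ t → (a <ᵇ b) ∧ (a <ᵇ c) ∧ t)
    (shrub≡partialShrub n rest (suc-injective (suc-injective (suc-injective len))))

<ᵇ-shift : ∀ k a b → (k + a <ᵇ k + b) ≡ (a <ᵇ b)
<ᵇ-shift zero    a b = refl
<ᵇ-shift (suc k) a b = <ᵇ-shift k a b

partialShrub-shift : ∀ k xs → partialShrub (map (k +_) xs) ≡ partialShrub xs
partialShrub-shift k []                 = refl
partialShrub-shift k (a ∷ [])           = refl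
partialShrub-shift k (a ∷ b ∷ [])       = <ᵇ-shift k a b
partialShrub-shift k (a ∷ b ∷ c ∷ rest) =
  cong₂ _∧_ (<ᵇ-shift k a b) (cong₂ _∧_ (<ᵇ-shift k a c) (partialShrub-shift k rest))

partialShrub-split⁻ : ∀ α x β → All (_< x) α → All (_< x) β → (∀ {a b} → a ∈ α → b ∈ β → b < a) →
  T (partialShrub (α ++ x ∷ β)) → T (partialShrub α) × T (partialShrub β) × (β ≡ [] ⊎ mod3 (length α) ≡ 2)
partialShrub-split⁻ []          x []          _ _ _ _ = tt , tt , inj₁ refl
partialShrub-split⁻ []          x (y ∷ [])    _ (y<x ∷ _) _ t = ⊥-elim (<-asym y<x (<ᵇ⇒< x y t))
partialShrub-split⁻ []          x (y ∷ z ∷ β) _ (y<x ∷ _) _ t = ⊥-elim (<-asym y<x (<ᵇ⇒< x y (proj₁ (∧-elim t))))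
partialShrub-split⁻ (a ∷ [])    x []          _ _ _ _ = tt , tt , inj₁ refl
partialShrub-split⁻ (a ∷ [])    x (y ∷ β)     _ _ β<α t =
  ⊥-elim (<-asym (β<α (here refl) (here refl)) (<ᵇ⇒< a y (proj₁ (∧-elim (proj₂ (∧-elim {a <ᵇ x} t))))))
partialShrub-split⁻ (a ∷ b ∷ []) x β          _ _ _ t =
  let (a<b , rest) = ∧-elim {a <ᵇ b} t in a<b , proj₂ (∧-elim {a <ᵇ x} rest) , inj₂ refl
partialShrub-split⁻ (a ∷ b ∷ c ∷ α) x β (_ ∷ _ ∷ _ ∷ α<x) β<x β<α t =
  let (a<b , t₁) = ∧-elim {a <ᵇ b} t ; (a<c , t₂) = ∧-elim {a <ᵇ c} t₁
      (shα , shβ , position) = partialShrub-split⁻ α x β α<x β<x (λ p q → β<α (there (there (there p))) q) t₂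
  in ∧-intro a<b (∧-intro a<c shα) , shβ , position

partialShrub-split⁺ : ∀ α x β → All (_< x) α →
  T (partialShrub α) → T (partialShrub β) → (β ≡ [] ⊎ mod3 (length α) ≡ 2) → T (partialShrub (α ++ x ∷ β))
partialShrub-split⁺ []           x []      _          _   _   _        = tt
partialShrub-split⁺ []           x (y ∷ β) _          _   _   (inj₁ ())
partialShrub-split⁺ []           x (y ∷ β) _          _   _   (inj₂ ())
partialShrub-split⁺ (a ∷ [])     x []      (a<x ∷ _)  _   _   _        = <⇒<ᵇ a<x
partialShrub-split⁺ (a ∷ [])     x (y ∷ β) _          _   _   (inj₁ ())
partialShrub-split⁺ (a ∷ [])     x (y ∷ β) _          _   _   (inj₂ ())
partialShrub-split⁺ (a ∷ b ∷ []) x β       (a<x ∷ _)  a<b shβ _        = ∧-intro a<b (∧-intro (<⇒<ᵇ a<x) shβ)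
partialShrub-split⁺ (a ∷ b ∷ c ∷ α) x β (_ ∷ _ ∷ _ ∷ α<x) t shβ position =
  let (a<b , t₁) = ∧-elim {a <ᵇ b} t ; (a<c , shα) = ∧-elim {a <ᵇ c} t₁
  in ∧-intro a<b (∧-intro a<c (partialShrub-split⁺ α x β α<x shα shβ position))

record Good (m : ℕ) (π : List ℕ) : Set where
  constructor good
  field
    perm      : IsPerm m π
    avoids    : ¬ Has132 π
    shrubLike : T (partialShrub π)

isGood : List ℕ → Bool
isGood π = avoids132 π ∧ partialShrub π

𝒮 : ℕ → List (List ℕ)
𝒮 m = filter (λ π → T? (isGood π)) (perms m)

s : ℕ → ℕ
s m = length (𝒮 m)

∈𝒮⁻ : ∀ m {π} → π ∈ 𝒮 m → Good m π
∈𝒮⁻ m {π} π∈ with ∈-filter⁻ (λ π → T? (isGood π)) {xs = perms m} π∈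
... | π∈perms , t = let (avoids , shrubLike) = ∧-elim {avoids132 π} t in
  good (∈-perms⁻ m π∈perms) (avoids132⇒¬Has132 π avoids) shrubLike

∈𝒮⁺ : ∀ m {π} → Good m π → π ∈ 𝒮 m
∈𝒮⁺ m {π} (good perm avoids shrubLike) =
  ∈-filter⁺ (λ π → T? (isGood π)) (∈-perms⁺ m perm) (∧-intro (¬Has132⇒avoids132 π avoids) shrubLike)

𝒮-unique : ∀ m → Unique (𝒮 m)
𝒮-unique m = Unique.filter⁺ (λ π → T? (isGood π)) (perms-unique m)

glue : ℕ → ℕ → List ℕ → List ℕ → List ℕ
glue m p α β = map ((m ∸ p) +_) α ++ m ∷ β

-- Admissible lengths p of the part left of the maximum: p = m (the maximum comes last)
-- or p ≡ 2 (mod 3) (the maximum closes a block).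
allowed : ℕ → ℕ → Bool
allowed m p = (p ≡ᵇ m) ∨ (mod3 p ≡ᵇ 2)

allowed⁻ : ∀ m p → T (allowed m p) → p ≡ m ⊎ mod3 p ≡ 2
allowed⁻ m p ok with Equivalence.to (T-∨ {p ≡ᵇ m}) ok
... | inj₁ p≡m = inj₁ (≡ᵇ⇒≡ p m p≡m)
... | inj₂ p≡2 = inj₂ (≡ᵇ⇒≡ (mod3 p) 2 p≡2)

shift-bounded : ∀ m p {α} → p ≤ m → All (_< p) α → All (_< m) (map ((m ∸ p) +_) α)
shift-bounded m p p≤m α<p = All.map⁺ (All.map (λ {a} a<p →
  subst ((m ∸ p) + a <_) (m∸n+n≡m p≤m) (+-monoʳ-< (m ∸ p) a<p)) α<p)

shift-lower : ∀ k {α x} → x ∈ map (k +_) α → k ≤ x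
shift-lower k x∈ with ∈-map⁻ (k +_) x∈
... | a , _ , refl = m≤m+n k a

raised-above : ∀ m p {β} → All (_< m ∸ p) β → All (_< m) β
raised-above m p β<c = All.map (λ b<c → <-≤-trans b<c (m∸n≤m m p)) β<c

below-raised : ∀ m p {α β a b} → All (_< m ∸ p) β → a ∈ map ((m ∸ p) +_) α → b ∈ β → b < a
below-raised m p β<c a∈ b∈ = <-≤-trans (All.lookup β<c b∈) (shift-lower (m ∸ p) a∈)

glue-perm : ∀ m p {α β} → p ≤ m → IsPerm p α → IsPerm (m ∸ p) β → IsPerm (suc m) (glue m p α β)
glue-perm m p {α} {β} p≤m (isPerm |α| α<p α!) (isPerm |β| β<c β!) = isPerm length≡ bounded unique
  where
  α′ : List ℕ
  α′ = map ((m ∸ p) +_) α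
  length≡ : length (α′ ++ m ∷ β) ≡ suc m
  length≡ = begin
    length (α′ ++ m ∷ β)       ≡⟨ length-++ α′ ⟩
    length α′ + suc (length β) ≡⟨ cong₂ (λ x y → x + suc y) (trans (length-map ((m ∸ p) +_) α) |α|) |β| ⟩
    p + suc (m ∸ p)            ≡⟨ +-suc p (m ∸ p) ⟩
    suc (p + (m ∸ p))          ≡⟨ cong suc (m+[n∸m]≡n p≤m) ⟩
    suc m                      ∎
  bounded : All (_< suc m) (α′ ++ m ∷ β)
  bounded = All.++⁺ (All.map m<n⇒m<1+n (shift-bounded m p p≤m α<p))
                    (≤-refl ∷ All.map m<n⇒m<1+n (raised-above m p β<c))
  unique : Unique (α′ ++ m ∷ β)
  unique = Unique.++⁺ (Unique.map⁺ (λ {x} {y} → +-cancelˡ-≡ (m ∸ p) x y) α!)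
    (All.map (λ b<m m≡b → <-irrefl (sym m≡b) b<m) (raised-above m p β<c) ∷ β!)
    λ { (x∈ , here refl)  → <-irrefl refl (All.lookup (shift-bounded m p p≤m α<p) x∈)
      ; (x∈ , there x∈β) → <-irrefl refl (below-raised m p β<c x∈ x∈β) }

-- Gluing good permutations at an allowed position gives a good permutation of length m + 1:
-- a 132 would lie inside one side, and the maximum sits where a shrub block allows it.
glue-good : ∀ m p {α β} → p ≤ m → T (allowed m p) → Good p α → Good (m ∸ p) β →
            Good (suc m) (glue m p α β)
glue-good m p {α} {β} p≤m ok (good α-perm α-avoids α-shrub) (good β-perm β-avoids β-shrub) =
  good (glue-perm m p p≤m α-perm β-perm) avoids shrubLike
  where
  open IsPerm
  α′ : List ℕ
  α′ = map ((m ∸ p) +_) α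
  α′<m : All (_< m) α′
  α′<m = shift-bounded m p p≤m (bounded α-perm)
  avoids : ¬ Has132 (α′ ++ m ∷ β)
  avoids h with Has132-split α′ m β α′<m (raised-above m p (bounded β-perm))
                  (below-raised m p (bounded β-perm)) h
  ... | inj₁ hα′ = α-avoids (Has132-shift⁻ (m ∸ p) α hα′)
  ... | inj₂ hβ  = β-avoids hβ
  position : β ≡ [] ⊎ mod3 (length α′) ≡ 2
  position with allowed⁻ m p ok
  ... | inj₁ refl = inj₁ (length≡0⇒[] (trans (length≡ β-perm) (n∸n≡0 m)))
    where
    length≡0⇒[] : ∀ {xs : List ℕ} → length xs ≡ 0 → xs ≡ []
    length≡0⇒[] {[]} _ = refl
  ... | inj₂ p≡2  = inj₂ (trans (cong mod3 (trans (length-map ((m ∸ p) +_) α) (length≡ α-perm))) p≡2)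
  shrubLike : T (partialShrub (α′ ++ m ∷ β))
  shrubLike = partialShrub-split⁺ α′ m β α′<m (subst T (sym (partialShrub-shift (m ∸ p) α)) α-shrub) β-shrub position

split-at-max : ∀ m {z} → IsPerm (suc m) z → ∃₂ λ α′ β → z ≡ α′ ++ m ∷ β
split-at-max m {z} (isPerm |z| z<1+m z!) with m ∈? z
... | yes m∈ = ∈-∃++ m∈
... | no  m∉ = ⊥-elim (<-irrefl refl (≤-trans (≤-reflexive (sym |z|)) (pigeonhole z 0 m z! z<m)))
  where
  z<m : All (λ x → 0 ≤ x × x < m) z
  z<m = All.tabulate λ {x} x∈ → z≤n , ≤∧≢⇒< (s≤s⁻¹ (All.lookup z<1+m x∈)) (λ x≡m → m∉ (subst (_∈ z) x≡m x∈))

unique-++⁻ : ∀ {A : Set} (xs : List A) {ys} → Unique (xs ++ ys) → Unique xs × Unique ys × (∀ {a b} → a ∈ xs → b ∈ ys → a ≢ b)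
unique-++⁻ []       ys!          = [] , ys! , λ ()
unique-++⁻ (x ∷ xs) (x∉ ∷ xsys!) with unique-++⁻ xs xsys!
... | xs! , ys! , apart = All.++⁻ˡ xs x∉ ∷ xs! , ys! ,
  λ { (here refl) b∈ → All.lookup (All.++⁻ʳ xs x∉) b∈ ; (there a∈) b∈ → apart a∈ b∈ }

record AroundMax (m : ℕ) (α′ β : List ℕ) : Set where
  field
    left-unique  : Unique α′
    right-unique : Unique β
    left-below   : All (_< m) α′
    right-below  : All (_< m) β
    apart        : ∀ {a b} → a ∈ α′ → b ∈ β → a ≢ b
    lengths      : length α′ + length β ≡ m

around-max : ∀ m α′ β → IsPerm (suc m) (α′ ++ m ∷ β) → AroundMax m α′ β
around-max m α′ β (isPerm |z| z<1+m z!) with unique-++⁻ α′ z!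
... | α′! , m∉β ∷ β! , apart = record
  { left-unique  = α′!
  ; right-unique = β!
  ; left-below   = All.tabulate λ {x} x∈ →
      ≤∧≢⇒< (s≤s⁻¹ (All.lookup (All.++⁻ˡ α′ z<1+m) x∈)) (apart x∈ (here refl))
  ; right-below  = All.tabulate λ {x} x∈ →
      ≤∧≢⇒< (s≤s⁻¹ (All.lookup (All.++⁻ʳ α′ z<1+m) (there x∈))) (λ x≡m → All.lookup m∉β x∈ (sym x≡m))
  ; apart        = λ a∈ b∈ → apart a∈ (there b∈)
  ; lengths      = suc-injective (begin
      suc (length α′ + length β) ≡⟨ +-suc (length α′) (length β) ⟨
      length α′ + suc (length β) ≡⟨ length-++ α′ ⟨
      length (α′ ++ m ∷ β)       ≡⟨ |z| ⟩
      suc m                      ∎)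
  }

left-above-right : ∀ {m α′ β} → AroundMax m α′ β → ¬ Has132 (α′ ++ m ∷ β) →
                   ∀ {a b} → a ∈ α′ → b ∈ β → b < a
left-above-right {α′ = α′} around avoids a∈ b∈ =
  ≤∧≢⇒< (≮⇒≥ (λ a<b → avoids (Has132-around α′ a∈ b∈ a<b (All.lookup right-below b∈))))
        (λ b≡a → apart a∈ b∈ (sym b≡a))
  where open AroundMax around

layers : ∀ {m} α β → Unique α → Unique β → All (_< m) α → All (_< m) β → length α + length β ≡ m →
         (∀ {a b} → a ∈ α → b ∈ β → b < a) → All (_< length β) β × All (length β ≤_) α
layers {m} α β α! β! α<m β<m lengths β<α = All.tabulate lower , All.tabulate upper
  where
  m∸|β| : m ∸ length β ≡ length α
  m∸|β| = trans (cong (_∸ length β) (sym lengths)) (m+n∸n≡m (length α) (length β))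
  lower : ∀ {b} → b ∈ β → b < length β
  lower {b} b∈ with b <? length β
  ... | yes b<|β| = b<|β|
  ... | no  b≮|β| = ⊥-elim (<-irrefl refl (≤-trans count (≤-trans (∸-monoʳ-≤ m (≮⇒≥ b≮|β|)) (≤-reflexive m∸|β|))))
    where
    -- b and the entries of α are distinct values in [b, m)
    count : suc (length α) ≤ m ∸ b
    count = pigeonhole (b ∷ α) b m (All.tabulate (λ a∈ b≡a → <-irrefl b≡a (β<α a∈ b∈)) ∷ α!)
      ((≤-refl , All.lookup β<m b∈) ∷ All.tabulate (λ a∈ → <⇒≤ (β<α a∈ b∈) , All.lookup α<m a∈))
  upper : ∀ {a} → a ∈ α → length β ≤ a
  upper {a} a∈ with a <? length β
  ... | no  a≮|β| = ≮⇒≥ a≮|β|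
  -- otherwise a and the entries of β would be distinct values in [0, |β|)
  ... | yes a<|β| = ⊥-elim (<-irrefl refl (pigeonhole (a ∷ β) 0 (length β)
    (All.tabulate (λ b∈ a≡b → <-irrefl (sym a≡b) (β<α a∈ b∈)) ∷ β!)
    ((z≤n , a<|β|) ∷ All.tabulate (λ b∈ → z≤n , <-trans (β<α a∈ b∈) a<|β|))))

unshift : ∀ k xs → All (k ≤_) xs → map (k +_) (map (_∸ k) xs) ≡ xs
unshift k []       []             = refl
unshift k (x ∷ xs) (k≤x ∷ k≤xs) = cong₂ _∷_ (m+[n∸m]≡n k≤x) (unshift k xs k≤xs)

data Glued (m : ℕ) : List ℕ → Set where
  glued : ∀ p {α β} → p ≤ m → T (allowed m p) → α ∈ 𝒮 p → β ∈ 𝒮 (m ∸ p) → Glued m (glue m p α β)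

Glued⇒∈𝒮 : ∀ m {z} → Glued m z → z ∈ 𝒮 (suc m)
Glued⇒∈𝒮 m (glued p p≤m ok α∈ β∈) = ∈𝒮⁺ (suc m) (glue-good m p p≤m ok (∈𝒮⁻ p α∈) (∈𝒮⁻ (m ∸ p) β∈))

decompose-at-max : ∀ m α′ β → Good (suc m) (α′ ++ m ∷ β) → Glued m (α′ ++ m ∷ β)
decompose-at-max m α′ β (good perm avoids shrubLike) =
  subst (Glued m) (cong (_++ m ∷ β) α′≡) (glued p p≤m ok (∈𝒮⁺ p α-good) (∈𝒮⁺ c β-good))
  where
  open AroundMax (around-max m α′ β perm)
  p c : ℕ
  p = length α′
  c = m ∸ p
  p≤m : p ≤ m
  p≤m = subst (p ≤_) lengths (m≤m+n p (length β))
  |β|≡c : length β ≡ c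
  |β|≡c = trans (sym (m+n∸m≡n p (length β))) (cong (_∸ p) lengths)
  β<α′ : ∀ {a b} → a ∈ α′ → b ∈ β → b < a
  β<α′ = left-above-right (around-max m α′ β perm) avoids
  β<c : All (_< c) β
  β<c = subst (λ k → All (_< k) β) |β|≡c
    (proj₁ (layers α′ β left-unique right-unique left-below right-below lengths β<α′))
  c≤α′ : All (c ≤_) α′
  c≤α′ = subst (λ k → All (k ≤_) α′) |β|≡c
    (proj₂ (layers α′ β left-unique right-unique left-below right-below lengths β<α′))
  α : List ℕ
  α = map (_∸ c) α′
  α′≡ : map (c +_) α ≡ α′
  α′≡ = unshift c α′ c≤α′
  shrubs : T (partialShrub α′) × T (partialShrub β) × (β ≡ [] ⊎ mod3 p ≡ 2)
  shrubs = partialShrub-split⁻ α′ m β left-below right-below β<α′ shrubLike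
  α-good : Good p α
  α-good = good
    (isPerm (length-map (_∸ c) α′)
            (All.map⁺ (All.tabulate λ {x} x∈ →
              subst (x ∸ c <_) (m∸[m∸n]≡n p≤m) (∸-monoˡ-< (All.lookup left-below x∈) (All.lookup c≤α′ x∈))))
            (Unique.map⁻ (subst Unique (sym α′≡) left-unique)))
    (λ h → avoids (Has132-++ˡ (m ∷ β) (subst Has132 α′≡ (Has132-shift⁺ c α h))))
    (subst T (partialShrub-shift c α) (subst (T ∘ partialShrub) (sym α′≡) (proj₁ shrubs)))
  β-good : Good c β
  β-good = good (isPerm |β|≡c β<c right-unique) (λ h → avoids (Has132-++ʳ α′ (startsLater h))) (proj₁ (proj₂ shrubs))
  ok : T (allowed m p)
  ok with proj₂ (proj₂ shrubs)
  ... | inj₁ refl = Equivalence.from (T-∨ {p ≡ᵇ m}) (inj₁ (≡⇒≡ᵇ p m (≤-antisym p≤m (m∸n≡0⇒m≤n (sym |β|≡c)))))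
  ... | inj₂ p≡2  = Equivalence.from (T-∨ {p ≡ᵇ m}) (inj₂ (≡⇒≡ᵇ (mod3 p) 2 p≡2))

∈𝒮⇒Glued : ∀ m {z} → z ∈ 𝒮 (suc m) → Glued m z
∈𝒮⇒Glued m z∈ with ∈𝒮⁻ (suc m) z∈
... | g with split-at-max m (Good.perm g)
... | α′ , β , refl = decompose-at-max m α′ β g

split-injective : ∀ {A : Set} (m : A) (xs xs′ : List A) {ys ys′} → m ∉ xs → m ∉ xs′ →
                  xs ++ m ∷ ys ≡ xs′ ++ m ∷ ys′ → xs ≡ xs′ × ys ≡ ys′
split-injective m []       []         _   _    eq = refl , ∷-injectiveʳ eq
split-injective m []       (x′ ∷ xs′) _   m∉′ eq with ∷-injective eq
... | refl , _ = ⊥-elim (m∉′ (here refl))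
split-injective m (x ∷ xs) []         m∉  _    eq with ∷-injective eq
... | refl , _ = ⊥-elim (m∉ (here refl))
split-injective m (x ∷ xs) (x′ ∷ xs′) m∉  m∉′ eq with ∷-injective eq
... | refl , eq′ with split-injective m xs xs′ (m∉ ∘ there) (m∉′ ∘ there) eq′
... | refl , ys≡ys′ = refl , ys≡ys′

-- Gluing is injective on good permutations (the position is recovered as |α|).
glue-injective : ∀ m {p q α α′ β β′} → p ≤ m → q ≤ m → α ∈ 𝒮 p → α′ ∈ 𝒮 q →
                 glue m p α β ≡ glue m q α′ β′ → p ≡ q × α ≡ α′ × β ≡ β′
glue-injective m {p} {q} {α} {α′} p≤m q≤m α∈ α′∈ eq
  with isPerm |α| α<p _ ← Good.perm (∈𝒮⁻ p α∈) | isPerm |α′| α′<q _ ← Good.perm (∈𝒮⁻ q α′∈)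
  with split-injective m (map ((m ∸ p) +_) α) (map ((m ∸ q) +_) α′)
         (λ m∈ → <-irrefl refl (All.lookup (shift-bounded m p p≤m α<p) m∈))
         (λ m∈ → <-irrefl refl (All.lookup (shift-bounded m q q≤m α′<q) m∈)) eq
... | lefts , β≡β′ with trans (sym (trans (length-map _ α) |α|)) (trans (cong length lefts) (trans (length-map _ α′) |α′|))
... | refl = refl , map-injective (λ {x} {y} → +-cancelˡ-≡ (m ∸ p) x y) lefts , β≡β′

gluings : ℕ → ℕ → List (List ℕ)
gluings m p = if allowed m p then concatMap (λ α → map (glue m p α) (𝒮 (m ∸ p))) (𝒮 p) else []

candidates : ℕ → List (List ℕ)
candidates m = concatMap (gluings m) (upTo (suc m))

∈-if⁺ : ∀ {A : Set} b {x : A} {xs} → T b → x ∈ xs → x ∈ (if b then xs else [])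
∈-if⁺ true _ x∈ = x∈

∈-if⁻ : ∀ {A : Set} b {x : A} {xs} → x ∈ (if b then xs else []) → T b × x ∈ xs
∈-if⁻ true x∈ = tt , x∈

∈candidates⁺ : ∀ m {z} → Glued m z → z ∈ candidates m
∈candidates⁺ m (glued p p≤m ok α∈ β∈) =
  ∈-concatMap⁺ (gluings m) {xs = upTo (suc m)} (lose (∈-upTo⁺ (s≤s p≤m))
    (∈-if⁺ (allowed m p) ok (∈-concatMap⁺ (λ α → map (glue m p α) (𝒮 (m ∸ p))) (lose α∈ (∈-map⁺ (glue m p _) β∈)))))

∈gluings⁻ : ∀ m p {z} → z ∈ gluings m p → ∃₂ λ α β → α ∈ 𝒮 p × β ∈ 𝒮 (m ∸ p) × z ≡ glue m p α β
∈gluings⁻ m p z∈ with find (∈-concatMap⁻ (λ α → map (glue m p α) (𝒮 (m ∸ p))) {xs = 𝒮 p} (proj₂ (∈-if⁻ (allowed m p) z∈)))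
... | α , α∈ , z∈′ with ∈-map⁻ (glue m p α) z∈′
... | β , β∈ , z≡ = α , β , α∈ , β∈ , z≡

∈candidates⁻ : ∀ m {z} → z ∈ candidates m → Glued m z
∈candidates⁻ m z∈ with find (∈-concatMap⁻ (gluings m) {xs = upTo (suc m)} z∈)
... | p , p∈ , z∈′ with ∈gluings⁻ m p z∈′
... | α , β , α∈ , β∈ , refl = glued p (s≤s⁻¹ (∈-upTo⁻ p∈)) (proj₁ (∈-if⁻ (allowed m p) z∈′)) α∈ β∈

gluings-unique : ∀ m p → p ≤ m → Unique (gluings m p)
gluings-unique m p p≤m with allowed m p
... | false = []
... | true  = concatMap-unique (λ α → map (glue m p α) (𝒮 (m ∸ p))) (𝒮 p) (𝒮-unique p)
  (λ {α} _ → Unique.map⁺ (λ {β} {β′} eq → ∷-injectiveʳ (++-cancelˡ (map ((m ∸ p) +_) α) (m ∷ β) (m ∷ β′) eq)) (𝒮-unique (m ∸ p)))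
  λ {α} {α′} α∈ α′∈ z∈ z∈′ → let (β , _ , z≡) = ∈-map⁻ (glue m p α) z∈ ; (β′ , _ , z≡′) = ∈-map⁻ (glue m p α′) z∈′ in
    proj₁ (proj₂ (glue-injective m p≤m p≤m α∈ α′∈ (trans (sym z≡) z≡′)))

candidates-unique : ∀ m → Unique (candidates m)
candidates-unique m = concatMap-unique (gluings m) (upTo (suc m)) (Unique.upTo⁺ (suc m))
  (λ p∈ → gluings-unique m _ (s≤s⁻¹ (∈-upTo⁻ p∈)))
  λ {p} {q} p∈ q∈ z∈ z∈′ → let (α , β , α∈ , _ , z≡) = ∈gluings⁻ m p z∈ ; (α′ , β′ , α′∈ , _ , z≡′) = ∈gluings⁻ m q z∈′ in
    proj₁ (glue-injective m (s≤s⁻¹ (∈-upTo⁻ p∈)) (s≤s⁻¹ (∈-upTo⁻ q∈)) α∈ α′∈ (trans (sym z≡) z≡′))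

length-concatMap-applyUpTo : ∀ {A : Set} (f : ℕ → List A) (g : ℕ → ℕ) k →
  length (concatMap f (applyUpTo g k)) ≡ Σ k (λ i → length (f (g i)))
length-concatMap-applyUpTo f g zero    = refl
length-concatMap-applyUpTo f g (suc k) =
  trans (length-++ (f (g 0))) (cong (length (f (g 0)) +_) (length-concatMap-applyUpTo f (g ∘ suc) k))

length-pairs : ∀ {A B C : Set} (g : A → B → C) (xs : List A) (ys : List B) →
  length (concatMap (λ x → map (g x) ys) xs) ≡ length xs * length ys
length-pairs g []       ys = refl
length-pairs g (x ∷ xs) ys = trans (length-++ (map (g x) ys)) (cong₂ _+_ (length-map (g x) ys) (length-pairs g xs ys))

length-gluings : ∀ m p → length (gluings m p) ≡ (if allowed m p then s p * s (m ∸ p) else 0)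
length-gluings m p with allowed m p
... | true  = length-pairs (glue m p) (𝒮 p) (𝒮 (m ∸ p))
... | false = refl

≡ᵇ-refl : ∀ m → (m ≡ᵇ m) ≡ true
≡ᵇ-refl zero    = refl
≡ᵇ-refl (suc m) = ≡ᵇ-refl m

<⇒≡ᵇ-false : ∀ {p m} → p < m → (p ≡ᵇ m) ≡ false
<⇒≡ᵇ-false {zero}  {suc m} _         = refl
<⇒≡ᵇ-false {suc p} {suc m} (s<s p<m) = <⇒≡ᵇ-false p<m

length-candidates : ∀ m → length (candidates m) ≡ Σ m (splitTerm s m) + s m
length-candidates m = begin
  length (candidates m)                                ≡⟨ length-concatMap-applyUpTo (gluings m) (λ i → i) (suc m) ⟩
  Σ (suc m) (λ p → length (gluings m p))               ≡⟨ Σ-snoc m (λ p → length (gluings m p)) ⟩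
  Σ m (λ p → length (gluings m p)) + length (gluings m m) ≡⟨ cong₂ _+_ (Σ-cong m inner) last ⟩
  Σ m (splitTerm s m) + s m                            ∎
  where
  inner : ∀ p → p < m → length (gluings m p) ≡ splitTerm s m p
  inner p p<m = trans (length-gluings m p)
    (cong (λ b → if b ∨ (mod3 p ≡ᵇ 2) then s p * s (m ∸ p) else 0) (<⇒≡ᵇ-false p<m))
  last : length (gluings m m) ≡ s m
  last = begin
    length (gluings m m)                                      ≡⟨ length-gluings m m ⟩
    (if allowed m m then s m * s (m ∸ m) else 0)              ≡⟨ cong (λ b → if b ∨ (mod3 m ≡ᵇ 2) then s m * s (m ∸ m) else 0) (≡ᵇ-refl m) ⟩
    s m * s (m ∸ m)                                           ≡⟨ cong (λ k → s m * s k) (n∸n≡0 m) ⟩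
    s m * 1                                                   ≡⟨ *-identityʳ (s m) ⟩
    s m                                                       ∎

s-recurrence : ∀ m → s (suc m) ≡ Σ m (splitTerm s m) + s m
s-recurrence m = trans
  (unique-length-≡ (𝒮 (suc m)) (candidates m) (𝒮-unique (suc m)) (candidates-unique m)
    (∈candidates⁺ m ∘ ∈𝒮⇒Glued m) (Glued⇒∈𝒮 m ∘ ∈candidates⁻ m))
  (length-candidates m)

S2-132≡𝒮 : ∀ n → length (S2-132 n) ≡ s (3 * n)
S2-132≡𝒮 n = unique-length-≡ (S2-132 n) (𝒮 (3 * n))
  (Unique.filter⁺ isShrub? (perms-unique (3 * n))) (𝒮-unique (3 * n)) to from
  where
  isShrub? : (π : List ℕ) → Dec (T (avoids132 π ∧ shrub π))
  isShrub? π = T? (avoids132 π ∧ shrub π)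
  same : ∀ {π} → π ∈ perms (3 * n) → shrub π ≡ partialShrub π
  same {π} π∈ = shrub≡partialShrub n π (IsPerm.length≡ (∈-perms⁻ (3 * n) π∈))
  to : ∀ {π} → π ∈ S2-132 n → π ∈ 𝒮 (3 * n)
  to {π} π∈ with ∈-filter⁻ isShrub? {xs = perms (3 * n)} π∈
  ... | π∈perms , t = ∈-filter⁺ (λ π → T? (isGood π)) π∈perms (subst (λ b → T (avoids132 π ∧ b)) (same π∈perms) t)
  from : ∀ {π} → π ∈ 𝒮 (3 * n) → π ∈ S2-132 n
  from {π} π∈ with ∈-filter⁻ (λ π → T? (isGood π)) {xs = perms (3 * n)} π∈
  ... | π∈perms , t = ∈-filter⁺ isShrub? π∈perms (subst (λ b → T (avoids132 π ∧ b)) (sym (same π∈perms)) t)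

corollary8 : (n : ℕ) → length (S2-132 n) ≡ ((4 * n) C n) / suc (3 * n)
corollary8 n = begin
  length (S2-132 n)          ≡⟨ S2-132≡𝒮 n ⟩
  s (3 * n)                  ≡⟨ SolveRecurrence.s-closed-form s refl s-recurrence n ⟩
  raney 1 n                  ≡⟨ raney-closed-form n ⟨
  ((4 * n) C n) / suc (3 * n) ∎
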